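{- Let $S$ be a caterpillar sequence and $3\le i\le|S|$. Then (i) $\mathrm{Left}_i(S)\preceq S$; (ii) $\mathrm{Right}_i(S)\preceq S$; (iii) $\mathrm{Left}_i(\widetilde{S})=\widetilde{\mathrm{Right}_i(S)}$.
   Context: A caterpillar sequence is a finite sequence $S=(s_1,\dots,s_k)$, $k\ge1$, of non-negative integers with $s_1,s_k\ge1$, and $s_1\ge2$ if $k=1$; its size is $|S|=k+\sum_j s_j$ and its reversal is $\widetilde S=(s_k,\dots,s_1)$. Let $f(S)=(s_1)$ if $k=1$ and $f(S)=(s_1+1,s_2+2,\dots,s_{k-1}+2,s_k+1)$ if $k>1$. For caterpillar sequences $S'$ of length $k'$ and $S$ of length $k$, $S'\preceq S$ means $k'\le k$ and there is $i\in\{0,\dots,k-k'\}$ with $f(S')[j]\le f(S)[j+i]$ for all $1\le j\le k'$. For $3\le i\le|S|$: $\mathrm{Left}_i(S)=S$ if $i=|S|$; $\mathrm{Left}_i(S)=\mathrm{Left}_i(s_1,\dots,s_{k-1},s_k-1)$ if $i<|S|$, $s_k\ge2$; $\mathrm{Left}_i(S)=\mathrm{Left}_i(s_1,\dots,s_{k-2},s_{k-1}+1)$ if $i<|S|$, $s_k=1$. Symmetrically, $\mathrm{Right}_i(S)=S$ if $i=|S|$; $\mathrm{Right}_i(S)=\mathrm{Right}_i(s_1-1,s_2,\dots,s_k)$ if $i<|S|$, $s_1\ge2$; $\mathrm{Right}_i(S)=\mathrm{Right}_i(s_2+1,s_3,\dots,s_k)$ if $i<|S|$, $s_1=1$. 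-}

module Defs where

open import Data.Nat using (ℕ; zero; suc; _+_; _∸_; _≤_; _<ᵇ_)
open import Data.List using (List; []; _∷_; length; take; drop; reverse)
open import Data.Nat.ListAction using (sum)
open import Data.Empty using (⊥)
open import Data.List.Relation.Binary.Pointwise using (Pointwise)
open import Data.Product using (Σ; _×_; ∃)
open import Data.Bool using (if_then_else_)
open import Data.Unit using (⊤)

head0 : List ℕ → ℕ
head0 [] = 0
head0 (s ∷ _) = s

last0 : List ℕ → ℕ
last0 [] = 0
last0 (s ∷ []) = s
last0 (_ ∷ t ∷ r) = last0 (t ∷ r)

IsCaterpillar : List ℕ → Set
IsCaterpillar [] = ⊥
IsCaterpillar (s ∷ []) = 2 ≤ s
IsCaterpillar (s ∷ t ∷ r) = (1 ≤ s) × (1 ≤ last0 (t ∷ r))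

size : List ℕ → ℕ
size S = length S + sum S

fTail : List ℕ → List ℕ
fTail [] = []
fTail (s ∷ []) = suc s ∷ []
fTail (s ∷ t ∷ r) = (s + 2) ∷ fTail (t ∷ r)

f : List ℕ → List ℕ
f [] = []
f (s ∷ []) = s ∷ []
f (s ∷ t ∷ r) = suc s ∷ fTail (t ∷ r)

_⪯_ : List ℕ → List ℕ → Set
S' ⪯ S = (length S' ≤ length S) ×
  ∃ λ i → (i + length S' ≤ length S) ×
          Pointwise _≤_ (f S') (take (length S') (drop i (f S)))

-- one step of the recursion defining Left_i (the case i < |S|):
--   s_k ≥ 2 : (s₁,…,s_{k-1},s_k-1)
--   s_k = 1 : (s₁,…,s_{k-2},s_{k-1}+1)
-- (other inputs do not occur for caterpillar sequences; left unchanged)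
leftStep : List ℕ → List ℕ
leftStep [] = []
leftStep (zero ∷ []) = zero ∷ []
leftStep (suc zero ∷ []) = suc zero ∷ []
leftStep (suc (suc s) ∷ []) = suc s ∷ []
leftStep (a ∷ zero ∷ []) = a ∷ zero ∷ []
leftStep (a ∷ suc zero ∷ []) = suc a ∷ []
leftStep (a ∷ suc (suc s) ∷ []) = a ∷ suc s ∷ []
leftStep (a ∷ b ∷ c ∷ r) = a ∷ leftStep (b ∷ c ∷ r)

rightStep : List ℕ → List ℕ
rightStep [] = []
rightStep (zero ∷ r) = zero ∷ r
rightStep (suc zero ∷ []) = suc zero ∷ []
rightStep (suc zero ∷ b ∷ r) = suc b ∷ r
rightStep (suc (suc s) ∷ r) = suc s ∷ r

-- The recursions, run with a fuel bound (each step lowers |S| by one, so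
-- fuel |S| suffices): stop when i = |S| (i.e. not i < |S|), else step.
iterUntil : (List ℕ → List ℕ) → ℕ → ℕ → List ℕ → List ℕ
iterUntil step zero i S = S
iterUntil step (suc n) i S =
  if i <ᵇ size S then iterUntil step n i (step S) else S

Left : ℕ → List ℕ → List ℕ
Left i S = iterUntil leftStep (size S) i S

Right : ℕ → List ℕ → List ℕ
Right i S = iterUntil rightStep (size S) i S

-- Right_i only ever lowers the first entry or merges the first entry into the
-- second, so Right_i(S) arises from S by cutting off a front segment and
-- replacing the new first entry by a value at most one larger (no larger if
-- nothing was cut). In f-coordinates this makes f(Right_i S) a pointwise
-- smaller infix of f(S), which is what ⪯ asks for. Left_i is Right_i
-- conjugated by reversal, and f commutes with reversal, which gives the
-- statement for Left_i.
module Submission where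

open import Defs
open import Data.Nat using (ℕ; zero; suc; _+_; _≤_; s≤s; _<ᵇ_)
open import Data.Nat.Properties using (≤-refl; ≤-reflexive; ≤-trans; n≤1+n; m≤n+m; +-comm)
open import Data.Nat.ListAction.Properties using (sum-↭)
open import Data.List using (List; []; _∷_; _++_; _∷ʳ_; map; length; take; drop; reverse; initLast; _∷ʳ′_)
open import Data.List.Properties using (length-reverse; reverse-++; reverse-involutive; reverse-map; unfold-reverse; ++-assoc)
open import Data.List.Relation.Binary.Permutation.Propositional.Properties using (↭-reverse)
open import Data.List.Relation.Binary.Pointwise as Pointwise using (Pointwise; []; _∷_)
open import Data.List.Relation.Binary.Prefix.Heterogeneous using (Prefix; []; _∷_)
open import Data.List.Relation.Binary.Prefix.Heterogeneous.Properties as Prefix using (fromPointwise)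
open import Data.List.Relation.Binary.Infix.Heterogeneous using (Infix; here; there; MkView; toView; fromView)
open import Data.Product using (_×_; _,_; ∃)
open import Data.Bool using (true; false)
open import Function using (_∘_)
open import Relation.Binary.PropositionalEquality using (_≡_; refl; sym; trans; cong; cong₂; subst; subst₂; module ≡-Reasoning)

open ≡-Reasoning

private
  variable
    A B : Set
    R : A → B → Set

prefix⇒pointwise-take : ∀ {as bs} → Prefix R as bs → Pointwise R as (take (length as) bs)
prefix⇒pointwise-take []       = []
prefix⇒pointwise-take (r ∷ rs) = r ∷ prefix⇒pointwise-take rs

infix⇒pointwise-take-drop : ∀ {as bs} → Infix R as bs →
  ∃ λ d → (d + length as ≤ length bs) × Pointwise R as (take (length as) (drop d bs))
infix⇒pointwise-take-drop (here p) = 0 , Prefix.length-mono p , prefix⇒pointwise-take p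
infix⇒pointwise-take-drop (there q) with d , d+|as|≤|bs| , pw ← infix⇒pointwise-take-drop q =
  suc d , s≤s d+|as|≤|bs| , pw

reverse-++-++ : (xs ys zs : List A) → reverse (xs ++ ys ++ zs) ≡ reverse zs ++ reverse ys ++ reverse xs
reverse-++-++ xs ys zs = begin
  reverse (xs ++ ys ++ zs)                 ≡⟨ reverse-++ xs (ys ++ zs) ⟩
  reverse (ys ++ zs) ++ reverse xs         ≡⟨ cong (_++ reverse xs) (reverse-++ ys zs) ⟩
  (reverse zs ++ reverse ys) ++ reverse xs ≡⟨ ++-assoc (reverse zs) (reverse ys) (reverse xs) ⟩
  reverse zs ++ reverse ys ++ reverse xs   ∎

infix-reverse⁺ : ∀ {as bs} → Infix R as bs → Infix R (reverse as) (reverse bs)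
infix-reverse⁺ {R = R} {as} p with MkView pref {inf} pw suff ← toView p =
  subst (Infix R (reverse as)) (sym (reverse-++-++ pref inf suff))
    (fromView (MkView (reverse suff) (Pointwise.reverse⁺ pw) (reverse pref)))

reverse-∷-∷ʳ : ∀ (x : A) ys z → reverse (x ∷ ys ∷ʳ z) ≡ z ∷ reverse ys ∷ʳ x
reverse-∷-∷ʳ x ys z = begin
  reverse ((x ∷ ys) ∷ʳ z) ≡⟨ reverse-++ (x ∷ ys) (z ∷ []) ⟩
  z ∷ reverse (x ∷ ys)    ≡⟨ cong (z ∷_) (unfold-reverse x ys) ⟩
  z ∷ reverse ys ∷ʳ x     ∎

size-reverse : ∀ S → size (reverse S) ≡ size S
size-reverse S = cong₂ _+_ (length-reverse S) (sum-↭ (↭-reverse S))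

iterUntil-preserves : ∀ (step : List ℕ → List ℕ) (P : List ℕ → Set) →
  (∀ {T} → P T → P (step T)) → ∀ n i {T} → P T → P (iterUntil step n i T)
iterUntil-preserves step P step-pres zero    i p = p
iterUntil-preserves step P step-pres (suc n) i {T} p with i <ᵇ size T
... | true  = iterUntil-preserves step P step-pres n i (step-pres p)
... | false = p

iterUntil-conjugate : ∀ (step step′ h : List ℕ → List ℕ) →
  (∀ T → size (h T) ≡ size T) → (∀ T → step (h T) ≡ h (step′ T)) →
  ∀ n i T → iterUntil step n i (h T) ≡ h (iterUntil step′ n i T)
iterUntil-conjugate step step′ h size-h comm zero    i T = refl
iterUntil-conjugate step step′ h size-h comm (suc n) i T rewrite size-h T with i <ᵇ size T
... | true rewrite comm T = iterUntil-conjugate step step′ h size-h comm n i (step′ T)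
... | false = refl

length-fTail : ∀ S → length (fTail S) ≡ length S
length-fTail []          = refl
length-fTail (s ∷ [])    = refl
length-fTail (s ∷ t ∷ r) = cong suc (length-fTail (t ∷ r))

length-f : ∀ S → length (f S) ≡ length S
length-f []          = refl
length-f (s ∷ [])    = refl
length-f (s ∷ t ∷ r) = cong suc (length-fTail (t ∷ r))

fTail-∷ʳ : ∀ ys z → fTail (ys ∷ʳ z) ≡ map (_+ 2) ys ∷ʳ suc z
fTail-∷ʳ []           z = refl
fTail-∷ʳ (y ∷ [])     z = refl
fTail-∷ʳ (y ∷ y′ ∷ ys) z = cong (y + 2 ∷_) (fTail-∷ʳ (y′ ∷ ys) z)

f-∷-∷ʳ : ∀ x ys z → f (x ∷ ys ∷ʳ z) ≡ suc x ∷ map (_+ 2) ys ∷ʳ suc z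
f-∷-∷ʳ x []       z = refl
f-∷-∷ʳ x (y ∷ ys) z = cong (suc x ∷_) (fTail-∷ʳ (y ∷ ys) z)

f-reverse : ∀ S → f (reverse S) ≡ reverse (f S)
f-reverse [] = refl
f-reverse (x ∷ S) with initLast S
... | []        = refl
... | ys ∷ʳ′ z = begin
  f (reverse (x ∷ ys ∷ʳ z))                           ≡⟨ cong f (reverse-∷-∷ʳ x ys z) ⟩
  f (z ∷ reverse ys ∷ʳ x)                             ≡⟨ f-∷-∷ʳ z (reverse ys) x ⟩
  suc z ∷ map (_+ 2) (reverse ys) ∷ʳ suc x            ≡⟨ cong (λ m → suc z ∷ m ∷ʳ suc x) (reverse-map (_+ 2) ys) ⟩
  suc z ∷ reverse (map (_+ 2) ys) ∷ʳ suc x            ≡⟨ sym (reverse-∷-∷ʳ (suc x) (map (_+ 2) ys) (suc z)) ⟩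
  reverse (suc x ∷ map (_+ 2) ys ∷ʳ suc z)            ≡⟨ cong reverse (sym (f-∷-∷ʳ x ys z)) ⟩
  reverse (f (x ∷ ys ∷ʳ z))                           ∎

infix⇒⪯ : ∀ {T S} → Infix _≤_ (f T) (f S) → T ⪯ S
infix⇒⪯ {T} {S} p with d , d+|fT|≤|fS| , pw ← infix⇒pointwise-take-drop p
  rewrite length-f T | length-f S =
  ≤-trans (m≤n+m (length T) d) d+|fT|≤|fS| , d , d+|fT|≤|fS| , pw

-- Trimmed slack T S: T = x ∷ R and S = ys ++ y ∷ R with x ≤ slack + y, where
-- the slack is 1 once ys ≠ []. The slack is harmless because the entry of f S
-- at y is then y + 2 (interior) or y + 1 (last), one more than the entry of
-- f T at x.
data Trimmed (slack : ℕ) : List ℕ → List ℕ → Set where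
  here  : ∀ {x y R} → x ≤ slack + y → Trimmed slack (x ∷ R) (y ∷ R)
  there : ∀ {T y S} → Trimmed 1 T S → Trimmed slack T (y ∷ S)

Trimmed-rightStep : ∀ {slack T S} → Trimmed slack T S → Trimmed slack (rightStep T) S
Trimmed-rightStep (here {zero} x≤y)                 = here x≤y
Trimmed-rightStep (here {suc zero} {R = []} x≤y)    = here x≤y
Trimmed-rightStep (here {suc zero} {R = _ ∷ _} _)   = there (here ≤-refl)
Trimmed-rightStep (here {suc (suc x)} x≤y)          = here (≤-trans (n≤1+n _) x≤y)
Trimmed-rightStep (there t)                         = there (Trimmed-rightStep t)

prefix-refl : ∀ (xs : List ℕ) → Prefix _≤_ xs xs
prefix-refl xs = fromPointwise (Pointwise.refl ≤-refl)

Trimmed₁-infix-fTail : ∀ {T S} → Trimmed 1 T S → Infix _≤_ (f T) (fTail S)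
Trimmed₁-infix-fTail (here {R = []} x≤1+y) = here (x≤1+y ∷ [])
Trimmed₁-infix-fTail (here {y = y} {R = c ∷ R} x≤1+y) =
  here (≤-trans (s≤s x≤1+y) (≤-reflexive (+-comm 2 y)) ∷ prefix-refl (fTail (c ∷ R)))
Trimmed₁-infix-fTail (there {S = _ ∷ _} t) = there (Trimmed₁-infix-fTail t)

Trimmed₀-infix : ∀ {T S} → Trimmed 0 T S → Infix _≤_ (f T) (f S)
Trimmed₀-infix (here {R = []} x≤y)    = here (x≤y ∷ [])
Trimmed₀-infix (here {R = c ∷ R} x≤y) = here (s≤s x≤y ∷ prefix-refl (fTail (c ∷ R)))
Trimmed₀-infix (there {S = _ ∷ _} t)  = there (Trimmed₁-infix-fTail t)

Right-infix : ∀ i S → Infix _≤_ (f (Right i S)) (f S)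
Right-infix i []      = here []
Right-infix i (x ∷ r) =
  Trimmed₀-infix (iterUntil-preserves rightStep (λ T → Trimmed 0 T (x ∷ r))
                    Trimmed-rightStep (size (x ∷ r)) i (here ≤-refl))

leftStep-∷ : ∀ a b c r → leftStep (a ∷ b ∷ c ∷ r) ≡ a ∷ leftStep (b ∷ c ∷ r)
leftStep-∷ zero          zero          c r = refl
leftStep-∷ zero          (suc zero)    c r = refl
leftStep-∷ zero          (suc (suc b)) c r = refl
leftStep-∷ (suc zero)    zero          c r = refl
leftStep-∷ (suc zero)    (suc zero)    c r = refl
leftStep-∷ (suc zero)    (suc (suc b)) c r = refl
leftStep-∷ (suc (suc a)) zero          c r = refl
leftStep-∷ (suc (suc a)) (suc zero)    c r = refl
leftStep-∷ (suc (suc a)) (suc (suc b)) c r = refl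

leftStep-++ : ∀ xs b a → leftStep (xs ++ b ∷ a ∷ []) ≡ xs ++ leftStep (b ∷ a ∷ [])
leftStep-++ []               b a = refl
leftStep-++ (x ∷ [])         b a = leftStep-∷ x b a []
leftStep-++ (x ∷ y ∷ [])     b a = trans (leftStep-∷ x y b (a ∷ [])) (cong (x ∷_) (leftStep-++ (y ∷ []) b a))
leftStep-++ (x ∷ y ∷ z ∷ zs) b a =
  trans (leftStep-∷ x y z (zs ++ b ∷ a ∷ [])) (cong (x ∷_) (leftStep-++ (y ∷ z ∷ zs) b a))

leftStep-reverse-pair : ∀ a b → leftStep (b ∷ a ∷ []) ≡ reverse (rightStep (a ∷ b ∷ []))
leftStep-reverse-pair zero          zero          = refl
leftStep-reverse-pair zero          (suc zero)    = refl
leftStep-reverse-pair zero          (suc (suc b)) = refl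
leftStep-reverse-pair (suc zero)    zero          = refl
leftStep-reverse-pair (suc zero)    (suc zero)    = refl
leftStep-reverse-pair (suc zero)    (suc (suc b)) = refl
leftStep-reverse-pair (suc (suc a)) zero          = refl
leftStep-reverse-pair (suc (suc a)) (suc zero)    = refl
leftStep-reverse-pair (suc (suc a)) (suc (suc b)) = refl

rightStep-++ : ∀ a b r → rightStep (a ∷ b ∷ []) ++ r ≡ rightStep (a ∷ b ∷ r)
rightStep-++ zero          b r = refl
rightStep-++ (suc zero)    b r = refl
rightStep-++ (suc (suc a)) b r = refl

leftStep-reverse : ∀ T → leftStep (reverse T) ≡ reverse (rightStep T)
leftStep-reverse []                = refl
leftStep-reverse (zero ∷ [])       = refl
leftStep-reverse (suc zero ∷ [])   = refl
leftStep-reverse (suc (suc x) ∷ []) = refl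
leftStep-reverse (a ∷ b ∷ r) = begin
  leftStep (reverse (a ∷ b ∷ r))                    ≡⟨ cong leftStep (reverse-++ (a ∷ b ∷ []) r) ⟩
  leftStep (reverse r ++ b ∷ a ∷ [])                ≡⟨ leftStep-++ (reverse r) b a ⟩
  reverse r ++ leftStep (b ∷ a ∷ [])                ≡⟨ cong (reverse r ++_) (leftStep-reverse-pair a b) ⟩
  reverse r ++ reverse (rightStep (a ∷ b ∷ []))     ≡⟨ sym (reverse-++ (rightStep (a ∷ b ∷ [])) r) ⟩
  reverse (rightStep (a ∷ b ∷ []) ++ r)             ≡⟨ cong reverse (rightStep-++ a b r) ⟩
  reverse (rightStep (a ∷ b ∷ r))                   ∎

Left-reverse : ∀ i S → Left i (reverse S) ≡ reverse (Right i S)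
Left-reverse i S = begin
  iterUntil leftStep (size (reverse S)) i (reverse S) ≡⟨ cong (λ n → iterUntil leftStep n i (reverse S)) (size-reverse S) ⟩
  iterUntil leftStep (size S) i (reverse S)           ≡⟨ iterUntil-conjugate leftStep rightStep reverse size-reverse leftStep-reverse (size S) i S ⟩
  reverse (Right i S)                                 ∎

Left-infix : ∀ i S → Infix _≤_ (f (Left i S)) (f S)
Left-infix i S = subst₂ (Infix _≤_) f-Left f-S (infix-reverse⁺ (Right-infix i (reverse S)))
  where
  f-Left : reverse (f (Right i (reverse S))) ≡ f (Left i S)
  f-Left = begin
    reverse (f (Right i (reverse S)))  ≡⟨ sym (f-reverse (Right i (reverse S))) ⟩
    f (reverse (Right i (reverse S)))  ≡⟨ cong f (sym (Left-reverse i (reverse S))) ⟩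
    f (Left i (reverse (reverse S)))   ≡⟨ cong (f ∘ Left i) (reverse-involutive S) ⟩
    f (Left i S)                       ∎

  f-S : reverse (f (reverse S)) ≡ f S
  f-S = trans (cong reverse (f-reverse S)) (reverse-involutive (f S))

lemma3 : (S : List ℕ) → IsCaterpillar S → (i : ℕ) → 3 ≤ i → i ≤ size S →
    (Left i S ⪯ S) × (Right i S ⪯ S) × (Left i (reverse S) ≡ reverse (Right i S))
lemma3 S _ i _ _ = infix⇒⪯ (Left-infix i S) , infix⇒⪯ (Right-infix i S) , Left-reverse i S
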